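{- Let $n$ be a positive integer and $\xi>2$ an integer. If $C_{\xi}(n)\neq\emptyset$, then $\xi\leq \log_2(n+1)+1$.
   Context: A partition of a positive integer $n$ is identified with a non-negative integer point $x=(x_1,\dots,x_n)\in\mathbb{R}^n$ satisfying $x_1+2x_2+\dots+nx_n=n$, where $x_i$ is the number of parts equal to $i$; write $x\vdash n$, and let $P(n)$ be the set of all partitions of $n$. The polytope of partitions is $P_n=\mathrm{conv}\,P(n)\subset\mathbb{R}^n$. A convex combination of points $y^1,\dots,y^k$ means $\sum_{j}\lambda_j y^j$ with all $\lambda_j>0$ and $\sum_j\lambda_j=1$. Every partition $x\vdash n$ that is not a vertex of $P_n$ is a convex combination of some partitions of $n$ different from $x$; let $\xi(x)$ be the minimal number of partitions of $n$ needed to express $x$ as such a convex combination. For an integer $\xi\ge 2$, $C_\xi(n)$ denotes the set of partitions $x\vdash n$, not vertices of $P_n$, with $\xi(x)=\xi$. -}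

module Defs where

open import Data.Nat using (ℕ; zero; suc; _+_; _*_; _<_)
open import Data.Fin using (Fin; toℕ)
import Data.Fin as F
open import Data.Integer using (+_)
open import Data.Rational as Q using (ℚ; 0ℚ; 1ℚ; _/_)
open import Data.Product using (Σ; ∃; _×_)
open import Relation.Binary.PropositionalEquality using (_≡_; _≢_)
open import Relation.Nullary using (¬_)

Σℕ : ∀ {k} → (Fin k → ℕ) → ℕ
Σℕ {zero}  f = 0
Σℕ {suc k} f = f F.zero + Σℕ (λ i → f (F.suc i))

Σℚ : ∀ {k} → (Fin k → ℚ) → ℚ
Σℚ {zero}  f = 0ℚ
Σℚ {suc k} f = f F.zero Q.+ Σℚ (λ i → f (F.suc i))

ℕ→ℚ : ℕ → ℚ
ℕ→ℚ m = + m / 1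

-- a point of ℕ^n ; coordinate i (0-based) is the multiplicity of part i+1
Point : ℕ → Set
Point n = Fin n → ℕ

IsPartition : (n : ℕ) → Point n → Set
IsPartition n x = Σℕ (λ i → suc (toℕ i) * x i) ≡ n

ConvComb : (n : ℕ) → Point n → ℕ → Set
ConvComb n x k =
  Σ (Fin k → Point n) λ y →
  Σ (Fin k → ℚ) λ λs →
    (∀ j → IsPartition n (y j)) ×
    (∀ j → y j ≢ x) ×
    (∀ j → 0ℚ Q.< λs j) ×
    (Σℚ λs ≡ 1ℚ) ×
    (∀ i → Σℚ (λ j → λs j Q.* ℕ→ℚ (y j i)) ≡ ℕ→ℚ (x i))

NotVertex : (n : ℕ) → Point n → Set
NotVertex n x = ∃ λ k → ConvComb n x k

HasXi : (n : ℕ) → Point n → ℕ → Set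
HasXi n x ξ = ConvComb n x ξ × (∀ k → k < ξ → ¬ ConvComb n x k)

InC : (ξ n : ℕ) → Point n → Set
InC ξ n x = IsPartition n x × NotVertex n x × HasXi n x ξ

-- Let x ⊢ n have d distinct parts and ξ(x) = ξ. The partitions in a shortest convex
-- combination for x use only parts of x, so after prepending the coordinate 1 (which turns
-- the condition Σ λⱼ = 1 into a linear equation) they are ξ vectors supported on d + 1
-- coordinates. If ξ > d + 1 they are linearly dependent, and Carathéodory's reduction drops
-- one of them, contradicting minimality; hence ξ ≤ d + 1.
-- On the other hand the 2ᵈ sub-multisets of x containing each distinct part at most once have
-- weights in {0, …, n}. If 2ᵈ > n + 1, two different ones A, B have the same weight, and x is
-- the midpoint of the partitions x − A + B and x − B + A, so ξ(x) = 2. Thus for ξ > 2 we get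
-- 2ᵈ ≤ n + 1 and ξ ≤ d + 1 ≤ ⌊log₂ (n + 1)⌋ + 1.

module Submission where

open import Defs
open import Data.Nat using (ℕ; suc; _+_; _≤_; _<_)
open import Data.Nat.Logarithm using (⌊log₂_⌋)
open import Data.Product using (∃)

open import Algebra.Bundles using (CommutativeRing)
open import Data.Empty using (⊥-elim)
open import Data.Fin as Fin using (Fin; zero; suc; punchIn; toℕ)
import Data.Fin.Properties as Finₚ
import Data.Integer as ℤ
import Data.Integer.Tactic.RingSolver as ℤ-Tactic
import Data.Nat as ℕ
open import Data.Nat using (_^_; _∸_; z≤n; s≤s)
import Data.Nat.Coprimality as Coprimality
open import Data.Nat.Logarithm using (⌊log₂⌋-mono-≤; ⌊log₂[2^n]⌋≡n)
import Data.Nat.Properties as ℕₚ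
open import Data.Nat.Tactic.RingSolver using (solve-∀)
open import Data.Product using (Σ; _×_; _,_; proj₁; proj₂)
open import Data.Rational as ℚ using (ℚ; 0ℚ; 1ℚ; _*_; -_; _-_)
import Data.Rational.Properties as ℚₚ
open import Data.Rational.Solver using (module +-*-Solver)
open import Data.Rational.Unnormalised as ℚᵘ using (mkℚᵘ)
import Data.Rational.Unnormalised.Properties as ℚᵘₚ
open import Data.Sum using (_⊎_; inj₁; inj₂; [_,_])
open import Data.Vec.Functional using ([]; _∷_; head; tail; insertAt)
open import Data.Vec.Functional.Properties using (insertAt-lookup; insertAt-punchIn)
open import Function using (_∘_)
open import Relation.Binary.Definitions using (tri<; tri≈; tri>)
open import Relation.Binary.PropositionalEquality
  using (_≡_; _≢_; _≗_; refl; sym; trans; cong; cong₂; module ≡-Reasoning)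
open import Relation.Nullary using (¬_; yes; no; ¬?)
open import Relation.Nullary.Decidable using (decidable-stable)
open import Relation.Unary using (Decidable)

open import Algebra.Properties.Semiring.Sum (CommutativeRing.semiring ℚₚ.+-*-commutativeRing)
  using (sum; sum-cong-≗; ∑-distrib-+; *-distribˡ-sum; *-distribʳ-sum; sum-remove; sum-replicate-zero)

open +-*-Solver

≤∧≢⇒< : ∀ {p q} → p ℚ.≤ q → p ≢ q → p ℚ.< q
≤∧≢⇒< {p} {q} p≤q p≢q with ℚₚ.<-cmp p q
... | tri< p<q _ _ = p<q
... | tri≈ _ p≡q _ = ⊥-elim (p≢q p≡q)
... | tri> _ _ q<p = ⊥-elim (ℚₚ.<-irrefl refl (ℚₚ.≤-<-trans p≤q q<p))

p≤q⇒0≤q-p : ∀ {p q} → p ℚ.≤ q → 0ℚ ℚ.≤ q - p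
p≤q⇒0≤q-p {p} p≤q = ℚₚ.≤-trans (ℚₚ.≤-reflexive (sym (ℚₚ.+-inverseʳ p))) (ℚₚ.+-monoˡ-≤ (- p) p≤q)

pos*nonneg≡0⇒≡0 : ∀ {a b} → 0ℚ ℚ.< a → 0ℚ ℚ.≤ b → a * b ≡ 0ℚ → b ≡ 0ℚ
pos*nonneg≡0⇒≡0 {a} {b} 0<a 0≤b ab≡0 = decidable-stable (b ℚₚ.≟ 0ℚ) λ b≢0 →
  ℚₚ.<-irrefl (sym ab≡0) (ℚₚ.positive⁻¹ (a * b) {{ℚₚ.pos*pos⇒pos a {{ℚ.positive 0<a}} b
                                                   {{ℚ.positive (≤∧≢⇒< 0≤b (b≢0 ∘ sym))}}}})

sum-neg : ∀ {m} (f : Fin m → ℚ) → sum (λ j → - f j) ≡ - sum f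
sum-neg f = begin
  sum (λ j → - f j)           ≡⟨ sum-cong-≗ (λ j → neg-1 (f j)) ⟨
  sum (λ j → - 1ℚ * f j)      ≡⟨ *-distribˡ-sum (- 1ℚ) f ⟨
  - 1ℚ * sum f                ≡⟨ neg-1 (sum f) ⟩
  - sum f                     ∎
  where
  open ≡-Reasoning
  neg-1 : ∀ a → - 1ℚ * a ≡ - a
  neg-1 = solve 1 (λ a → (:- con 1ℚ) :* a := :- a) refl

sum-nonneg : ∀ {k} (f : Fin k → ℚ) → (∀ j → 0ℚ ℚ.≤ f j) → 0ℚ ℚ.≤ sum f
sum-nonneg {ℕ.zero} f f≥0 = ℚₚ.≤-refl
sum-nonneg {suc k}  f f≥0 = ℚₚ.+-mono-≤ (f≥0 zero) (sum-nonneg (f ∘ suc) (f≥0 ∘ suc))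

sum≡0⇒≡0 : ∀ {k} (f : Fin k → ℚ) → (∀ j → 0ℚ ℚ.≤ f j) → sum f ≡ 0ℚ → ∀ j → f j ≡ 0ℚ
sum≡0⇒≡0 {suc k} f f≥0 sum≡0 j = ℚₚ.≤-antisym (begin
  f j                           ≡⟨ ℚₚ.+-identityʳ (f j) ⟨
  f j ℚ.+ 0ℚ                    ≤⟨ ℚₚ.+-monoʳ-≤ (f j) (sum-nonneg (f ∘ punchIn j) (f≥0 ∘ punchIn j)) ⟩
  f j ℚ.+ sum (f ∘ punchIn j)   ≡⟨ sum-remove {i = j} f ⟨
  sum f                         ≡⟨ sum≡0 ⟩
  0ℚ                            ∎) (f≥0 j)
  where open ℚₚ.≤-Reasoning

-- Linear combinations and linear dependence

linComb : ∀ {m r} → (Fin m → ℚ) → (Fin m → Fin r → ℚ) → Fin r → ℚ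
linComb μ w i = sum (λ j → μ j * w j i)

linComb-insertAt : ∀ {m r} (ν : Fin m → ℚ) (j₀ : Fin (suc m)) (s : ℚ) (w : Fin (suc m) → Fin r → ℚ) i →
                   linComb (insertAt ν j₀ s) w i ≡ s * w j₀ i ℚ.+ linComb ν (w ∘ punchIn j₀) i
linComb-insertAt ν j₀ s w i = begin
  linComb (insertAt ν j₀ s) w i
    ≡⟨ sum-remove {i = j₀} (λ j → insertAt ν j₀ s j * w j i) ⟩
  insertAt ν j₀ s j₀ * w j₀ i ℚ.+ sum (λ j → insertAt ν j₀ s (punchIn j₀ j) * w (punchIn j₀ j) i)
    ≡⟨ cong₂ ℚ._+_ (cong (_* w j₀ i) (insertAt-lookup ν j₀ s))
                   (sum-cong-≗ (λ j → cong (_* w (punchIn j₀ j) i) (insertAt-punchIn ν j₀ s j))) ⟩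
  s * w j₀ i ℚ.+ linComb ν (w ∘ punchIn j₀) i ∎
  where open ≡-Reasoning

linComb-neg : ∀ {m r} (μ : Fin m → ℚ) (w : Fin m → Fin r → ℚ) i →
              linComb (-_ ∘ μ) w i ≡ - linComb μ w i
linComb-neg μ w i = trans (sum-cong-≗ (λ j → sym (ℚₚ.neg-distribˡ-* (μ j) (w j i))))
                          (sum-neg (λ j → μ j * w j i))

linComb-sub-scaled : ∀ {m r} (λs μ : Fin m → ℚ) (t : ℚ) (w : Fin m → Fin r → ℚ) i →
                     linComb (λ j → λs j - t * μ j) w i ≡ linComb λs w i - t * linComb μ w i
linComb-sub-scaled λs μ t w i = begin
  sum (λ j → (λs j - t * μ j) * w j i)
    ≡⟨ sum-cong-≗ (λ j → distrib (λs j) (μ j) t (w j i)) ⟩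
  sum (λ j → λs j * w j i ℚ.+ - t * (μ j * w j i))
    ≡⟨ ∑-distrib-+ (λ j → λs j * w j i) (λ j → - t * (μ j * w j i)) ⟩
  linComb λs w i ℚ.+ sum (λ j → - t * (μ j * w j i))
    ≡⟨ cong (linComb λs w i ℚ.+_) (*-distribˡ-sum (- t) (λ j → μ j * w j i)) ⟨
  linComb λs w i ℚ.+ - t * linComb μ w i
    ≡⟨ regroup (linComb λs w i) t (linComb μ w i) ⟩
  linComb λs w i - t * linComb μ w i ∎
  where
  open ≡-Reasoning
  distrib : ∀ l m t v → (l - t * m) * v ≡ l * v ℚ.+ - t * (m * v)
  distrib = solve 4 (λ l m t v → (l :- t :* m) :* v := l :* v :+ (:- t) :* (m :* v)) refl
  regroup : ∀ a t b → a ℚ.+ - t * b ≡ a - t * b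
  regroup = solve 3 (λ a t b → a :+ (:- t) :* b := a :- t :* b) refl

linComb-sub-outer : ∀ {m r} (ν c : Fin m → ℚ) (v : Fin m → Fin r → ℚ) (b : Fin r → ℚ) i →
                    linComb ν (λ j i → v j i - c j * b i) i ≡ linComb ν v i - sum (λ j → ν j * c j) * b i
linComb-sub-outer ν c v b i = begin
  sum (λ j → ν j * (v j i - c j * b i))
    ≡⟨ sum-cong-≗ (λ j → distrib (ν j) (v j i) (c j) (b i)) ⟩
  sum (λ j → ν j * v j i ℚ.+ - (ν j * c j) * b i)
    ≡⟨ ∑-distrib-+ (λ j → ν j * v j i) (λ j → - (ν j * c j) * b i) ⟩
  linComb ν v i ℚ.+ sum (λ j → - (ν j * c j) * b i)
    ≡⟨ cong (linComb ν v i ℚ.+_) (*-distribʳ-sum (b i) (λ j → - (ν j * c j))) ⟨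
  linComb ν v i ℚ.+ sum (λ j → - (ν j * c j)) * b i
    ≡⟨ cong (λ s → linComb ν v i ℚ.+ s * b i) (sum-neg (λ j → ν j * c j)) ⟩
  linComb ν v i ℚ.+ - sum (λ j → ν j * c j) * b i
    ≡⟨ regroup (linComb ν v i) (sum (λ j → ν j * c j)) (b i) ⟩
  linComb ν v i - sum (λ j → ν j * c j) * b i ∎
  where
  open ≡-Reasoning
  distrib : ∀ n a c b → n * (a - c * b) ≡ n * a ℚ.+ - (n * c) * b
  distrib = solve 4 (λ n a c b → n :* (a :- c :* b) := n :* a :+ (:- (n :* c)) :* b) refl
  regroup : ∀ a s b → a ℚ.+ - s * b ≡ a - s * b
  regroup = solve 3 (λ a s b → a :+ (:- s) :* b := a :- s :* b) refl

linComb-zeroColumn : ∀ {m r} (μ : Fin m → ℚ) (w : Fin m → Fin r → ℚ) i →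
                     (∀ j → w j i ≡ 0ℚ) → linComb μ w i ≡ 0ℚ
linComb-zeroColumn {m} μ w i column≡0 =
  trans (sum-cong-≗ (λ j → trans (cong (μ j *_) (column≡0 j)) (ℚₚ.*-zeroʳ (μ j)))) (sum-replicate-zero m)

LinearDependency : ∀ {m r} → (Fin m → Fin r → ℚ) → Set
LinearDependency {m} w = Σ (Fin m → ℚ) λ μ → (∃ λ j → μ j ≢ 0ℚ) × (∀ i → linComb μ w i ≡ 0ℚ)

dependency-zeroColumn : ∀ {m r} (w : Fin m → Fin (suc r) → ℚ) → (∀ j → w j zero ≡ 0ℚ) →
                        LinearDependency (tail ∘ w) → LinearDependency w
dependency-zeroColumn w column≡0 (μ , nontrivial , dependent) = μ , nontrivial , λ where
  zero    → linComb-zeroColumn μ w zero column≡0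
  (suc i) → dependent i

module Elimination {m r} (w : Fin (suc m) → Fin (suc r) → ℚ) (j₀ : Fin (suc m))
                   (pivot≢0 : w j₀ zero ≢ 0ℚ) where
  private instance
    pivot-nonZero : ℚ.NonZero (w j₀ zero)
    pivot-nonZero = ℚ.≢-nonZero pivot≢0

  multiplier : Fin m → ℚ
  multiplier j = w (punchIn j₀ j) zero * ℚ.1/ w j₀ zero

  eliminated : Fin m → Fin (suc r) → ℚ
  eliminated j i = w (punchIn j₀ j) i - multiplier j * w j₀ i

  eliminated-pivotColumn : ∀ j → eliminated j zero ≡ 0ℚ
  eliminated-pivotColumn j = begin
    a - (a * ℚ.1/ p) * p   ≡⟨ cong (λ q → a - q) (ℚₚ.*-assoc a (ℚ.1/ p) p) ⟩
    a - a * (ℚ.1/ p * p)   ≡⟨ cong (λ q → a - a * q) (ℚₚ.*-inverseˡ p) ⟩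
    a - a * 1ℚ             ≡⟨ cong (λ q → a - q) (ℚₚ.*-identityʳ a) ⟩
    a - a                  ≡⟨ ℚₚ.+-inverseʳ a ⟩
    0ℚ                     ∎
    where
    open ≡-Reasoning
    a = w (punchIn j₀ j) zero
    p = w j₀ zero

  dependency : LinearDependency eliminated → LinearDependency w
  dependency (ν , (j₁ , ν≢0) , dependent) =
    μ , (punchIn j₀ j₁ , ν≢0 ∘ trans (sym (insertAt-punchIn ν j₀ (- S) j₁))) , λ i → begin
      linComb μ w i                                  ≡⟨ linComb-insertAt ν j₀ (- S) w i ⟩
      - S * w j₀ i ℚ.+ linComb ν (w ∘ punchIn j₀) i  ≡⟨ swap S (w j₀ i) (linComb ν (w ∘ punchIn j₀) i) ⟩
      linComb ν (w ∘ punchIn j₀) i - S * w j₀ i      ≡⟨ linComb-sub-outer ν multiplier (w ∘ punchIn j₀) (w j₀) i ⟨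
      linComb ν eliminated i                         ≡⟨ dependent i ⟩
      0ℚ                                             ∎
    where
    open ≡-Reasoning
    S : ℚ
    S = sum (λ j → ν j * multiplier j)
    μ : Fin (suc m) → ℚ
    μ = insertAt ν j₀ (- S)
    swap : ∀ s b l → - s * b ℚ.+ l ≡ l - s * b
    swap = solve 3 (λ s b l → (:- s) :* b :+ l := l :- s :* b) refl

linearDependency : ∀ {m r} (w : Fin m → Fin r → ℚ) → r < m → LinearDependency w
linearDependency {suc m} {ℕ.zero} w _ = (λ _ → 1ℚ) , (zero , ℚₚ.1≢0) , λ ()
linearDependency {suc m} {suc r}  w (s≤s r<m) with Finₚ.any? (λ j → ¬? (w j zero ℚₚ.≟ 0ℚ))
... | yes (j₀ , pivot≢0) = dependency (dependency-zeroColumn eliminated eliminated-pivotColumn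
                                         (linearDependency (tail ∘ eliminated) r<m))
  where open Elimination w j₀ pivot≢0
... | no noPivot = dependency-zeroColumn w (λ j → decidable-stable (w j zero ℚₚ.≟ 0ℚ) (noPivot ∘ (j ,_)))
                     (linearDependency (tail ∘ w) (ℕₚ.m<n⇒m<1+n r<m))

SupportedIn : ∀ {d r m} → (Fin d → Fin r) → (Fin m → Fin r → ℚ) → Set
SupportedIn e w = ∀ i → (∃ λ k → e k ≡ i) ⊎ (∀ j → w j i ≡ 0ℚ)

linearDependency-supportedIn : ∀ {m r d} (w : Fin m → Fin r → ℚ) {e : Fin d → Fin r} →
                               SupportedIn e w → d < m → LinearDependency w
linearDependency-supportedIn w {e} supported d<m with linearDependency (λ j k → w j (e k)) d<m
... | μ , nontrivial , dependent = μ , nontrivial , λ i →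
  [ (λ { (k , refl) → dependent k }) , linComb-zeroColumn μ w i ] (supported i)

linearDependency-positive : ∀ {m r} {w : Fin m → Fin r → ℚ} → LinearDependency w →
                            Σ (Fin m → ℚ) λ μ → (∃ λ j → 0ℚ ℚ.< μ j) × (∀ i → linComb μ w i ≡ 0ℚ)
linearDependency-positive {w = w} (μ , (j , μj≢0) , dependent) with ℚₚ.<-cmp 0ℚ (μ j)
... | tri< 0<μj _ _ = μ , (j , 0<μj) , dependent
... | tri≈ _ 0≡μj _ = ⊥-elim (μj≢0 (sym 0≡μj))
... | tri> _ _ μj<0 = -_ ∘ μ , (j , ℚₚ.neg-antimono-< μj<0) ,
                      λ i → trans (linComb-neg μ w i) (cong -_ (dependent i))

-- Carathéodory's reduction

record Combination (Admissible : ℚ → Set) {k r} (y : Fin k → Fin r → ℚ) (x : Fin r → ℚ) : Set where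
  field
    coeff      : Fin k → ℚ
    admissible : ∀ j → Admissible (coeff j)
    represents : ∀ i → linComb coeff y i ≡ x i

open Combination

NonnegCombination PositiveCombination : ∀ {k r} → (Fin k → Fin r → ℚ) → (Fin r → ℚ) → Set
NonnegCombination   = Combination (0ℚ ℚ.≤_)
PositiveCombination = Combination (0ℚ ℚ.<_)

positive⇒nonneg : ∀ {k r} {y : Fin k → Fin r → ℚ} {x} → PositiveCombination y x → NonnegCombination y x
positive⇒nonneg c = record { coeff = coeff c ; admissible = ℚₚ.<⇒≤ ∘ admissible c ; represents = represents c }

combination-removeZero : ∀ {A k r} {y : Fin (suc k) → Fin r → ℚ} {x} (c : Combination A y x) j₀ →
                         coeff c j₀ ≡ 0ℚ → Combination A (y ∘ punchIn j₀) x
combination-removeZero {y = y} {x} c j₀ cj₀≡0 = record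
  { coeff      = coeff c ∘ punchIn j₀
  ; admissible = admissible c ∘ punchIn j₀
  ; represents = represents′
  }
  where
  represents′ : ∀ i → linComb (coeff c ∘ punchIn j₀) (y ∘ punchIn j₀) i ≡ x i
  represents′ i = begin
    rest                           ≡⟨ ℚₚ.+-identityˡ rest ⟨
    0ℚ ℚ.+ rest                    ≡⟨ cong (ℚ._+ rest) (trans (sym (ℚₚ.*-zeroˡ (y j₀ i)))
                                                              (cong (_* y j₀ i) (sym cj₀≡0))) ⟩
    coeff c j₀ * y j₀ i ℚ.+ rest   ≡⟨ sum-remove {i = j₀} (λ j → coeff c j * y j i) ⟨
    linComb (coeff c) y i          ≡⟨ represents c i ⟩
    x i                            ∎
    where
    open ≡-Reasoning
    rest : ℚ
    rest = linComb (coeff c ∘ punchIn j₀) (y ∘ punchIn j₀) i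

positiveSubcombination : ∀ {k r} {y : Fin k → Fin r → ℚ} {x} → NonnegCombination y x →
                         Σ ℕ λ k′ → k′ ≤ k × Σ (Fin k′ → Fin k) λ ι → PositiveCombination (y ∘ ι) x
positiveSubcombination {k} c with Finₚ.any? (λ j → coeff c j ℚₚ.≟ 0ℚ)
positiveSubcombination {suc k} c | yes (j₀ , cj₀≡0)
  with positiveSubcombination (combination-removeZero c j₀ cj₀≡0)
... | k′ , k′≤k , ι , c′ = k′ , ℕₚ.m≤n⇒m≤1+n k′≤k , punchIn j₀ ∘ ι , c′
positiveSubcombination {k} c | no noZero = k , ℕₚ.≤-refl , (λ j → j) , record
  { coeff      = coeff c
  ; admissible = λ j → ≤∧≢⇒< (admissible c j) (noZero ∘ (j ,_) ∘ sym)
  ; represents = represents c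
  }

-- The key g must not depend on its proof argument: the base case compares g zero p with g zero p′.
argmin : ∀ {k} {P : Fin k → Set} → Decidable P → (g : ∀ j → .(P j) → ℚ) → ∃ P →
         Σ (Fin k) λ j₀ → Σ (P j₀) λ p₀ → ∀ j (p : P j) → g j₀ p₀ ℚ.≤ g j p
argmin {suc k} P? g (j , p) with Finₚ.any? (P? ∘ suc)
... | yes inTail with argmin (P? ∘ suc) (g ∘ suc) inTail
...   | j₁ , p₁ , min₁ with P? zero
...     | no ¬p₀ = suc j₁ , p₁ , λ { zero p → ⊥-elim (¬p₀ p) ; (suc j) p → min₁ j p }
...     | yes p₀ with g zero p₀ ℚₚ.≤? g (suc j₁) p₁
...       | yes g₀≤g₁ = zero , p₀ , λ { zero _ → ℚₚ.≤-refl ; (suc j) p → ℚₚ.≤-trans g₀≤g₁ (min₁ j p) }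
...       | no g₀≰g₁  = suc j₁ , p₁ , λ { zero _ → ℚₚ.<⇒≤ (ℚₚ.≰⇒> g₀≰g₁) ; (suc j) p → min₁ j p }
argmin {suc k} P? g (zero , p)  | no ∉tail =
  zero , p , λ { zero _ → ℚₚ.≤-refl ; (suc j) p → ⊥-elim (∉tail (j , p)) }
argmin {suc k} P? g (suc j , p) | no ∉tail = ⊥-elim (∉tail (j , p))

-- Move from the coefficients λ along −μ as far as nonnegativity allows: the step t is the least
-- ratio λⱼ / μⱼ over μⱼ > 0, and the coefficient at a minimising index j₀ becomes 0.
module CarathéodoryStep {k r} {y : Fin (suc k) → Fin r → ℚ} {x : Fin r → ℚ} (c : NonnegCombination y x)
                        (μ : Fin (suc k) → ℚ) (μ-positive : ∃ λ j → 0ℚ ℚ.< μ j)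
                        (dependent : ∀ i → linComb μ y i ≡ 0ℚ) where

  ratio : ∀ j → .(0ℚ ℚ.< μ j) → ℚ
  ratio j 0<μj = coeff c j * (ℚ.1/ μ j) {{ℚₚ.pos⇒nonZero (μ j) {{ℚ.positive 0<μj}}}}

  ratio-* : ∀ j (0<μj : 0ℚ ℚ.< μ j) → ratio j 0<μj * μ j ≡ coeff c j
  ratio-* j 0<μj = begin
    coeff c j * ℚ.1/ μ j * μ j     ≡⟨ ℚₚ.*-assoc (coeff c j) (ℚ.1/ μ j) (μ j) ⟩
    coeff c j * (ℚ.1/ μ j * μ j)   ≡⟨ cong (coeff c j *_) (ℚₚ.*-inverseˡ (μ j)) ⟩
    coeff c j * 1ℚ                 ≡⟨ ℚₚ.*-identityʳ (coeff c j) ⟩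
    coeff c j                      ∎
    where
    open ≡-Reasoning
    instance
      μj-nonZero : ℚ.NonZero (μ j)
      μj-nonZero = ℚₚ.pos⇒nonZero (μ j) {{ℚ.positive 0<μj}}

  minimiser : Σ (Fin (suc k)) λ j₀ → Σ (0ℚ ℚ.< μ j₀) λ p₀ → ∀ j (p : 0ℚ ℚ.< μ j) → ratio j₀ p₀ ℚ.≤ ratio j p
  minimiser = argmin (λ j → 0ℚ ℚₚ.<? μ j) ratio μ-positive

  j₀ : Fin (suc k)
  j₀ = proj₁ minimiser

  0<μj₀ : 0ℚ ℚ.< μ j₀
  0<μj₀ = proj₁ (proj₂ minimiser)

  t : ℚ
  t = ratio j₀ 0<μj₀

  t-nonneg : 0ℚ ℚ.≤ t
  t-nonneg = ℚₚ.nonNegative⁻¹ t {{ℚₚ.nonNeg*nonNeg⇒nonNeg (coeff c j₀) {{ℚ.nonNegative (admissible c j₀)}}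
               (ℚ.1/ μ j₀) {{ℚₚ.pos⇒nonNeg (ℚ.1/ μ j₀) {{ℚₚ.1/pos⇒pos (μ j₀)}}}}}}
    where
    instance
      μj₀-positive : ℚ.Positive (μ j₀)
      μj₀-positive = ℚ.positive 0<μj₀
      μj₀-nonZero : ℚ.NonZero (μ j₀)
      μj₀-nonZero = ℚₚ.pos⇒nonZero (μ j₀)

  t*μ≤coeff : ∀ j → t * μ j ℚ.≤ coeff c j
  t*μ≤coeff j with 0ℚ ℚₚ.<? μ j
  ... | yes 0<μj = ℚₚ.≤-trans (ℚₚ.*-monoʳ-≤-nonNeg (μ j) {{ℚ.nonNegative (ℚₚ.<⇒≤ 0<μj)}}
                                (proj₂ (proj₂ minimiser) j 0<μj))
                              (ℚₚ.≤-reflexive (ratio-* j 0<μj))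
  ... | no 0≮μj = ℚₚ.≤-trans (ℚₚ.*-monoˡ-≤-nonNeg t {{ℚ.nonNegative t-nonneg}} (ℚₚ.≮⇒≥ 0≮μj))
                    (ℚₚ.≤-trans (ℚₚ.≤-reflexive (ℚₚ.*-zeroʳ t)) (admissible c j))

  shifted : NonnegCombination y x
  shifted = record
    { coeff      = λ j → coeff c j - t * μ j
    ; admissible = p≤q⇒0≤q-p ∘ t*μ≤coeff
    ; represents = λ i → trans (linComb-sub-scaled (coeff c) μ t y i)
                         (trans (cong₂ (λ a b → a - t * b) (represents c i) (dependent i)) (minus-t*0 (x i) t))
    }
    where
    minus-t*0 : ∀ a t → a - t * 0ℚ ≡ a
    minus-t*0 = solve 2 (λ a t → a :- t :* con 0ℚ := a) refl

  shifted-j₀ : coeff shifted j₀ ≡ 0ℚ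
  shifted-j₀ = trans (cong (λ q → coeff c j₀ - q) (ratio-* j₀ 0<μj₀)) (ℚₚ.+-inverseʳ (coeff c j₀))

  step : Σ (Fin (suc k)) λ j₀ → NonnegCombination (y ∘ punchIn j₀) x
  step = j₀ , combination-removeZero shifted j₀ shifted-j₀

caratheodory : ∀ {k r} {y : Fin k → Fin r → ℚ} {x} → PositiveCombination y x → LinearDependency y →
               Σ ℕ λ k′ → k′ < k × Σ (Fin k′ → Fin k) λ ι → PositiveCombination (y ∘ ι) x
caratheodory {ℕ.zero} _ (_ , (() , _) , _)
caratheodory {suc k} {y = y} c dependency with linearDependency-positive {w = y} dependency
... | μ , μ-positive , dependent with CarathéodoryStep.step (positive⇒nonneg c) μ μ-positive dependent
... | j₀ , c′ with positiveSubcombination c′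
... | k′ , k′≤k , ι , c″ = k′ , s≤s k′≤k , punchIn j₀ ∘ ι , c″

positiveCombination-vanishes : ∀ {k r} {y : Fin k → Fin r → ℚ} {x} → PositiveCombination y x → ∀ i →
                               (∀ j → 0ℚ ℚ.≤ y j i) → x i ≡ 0ℚ → ∀ j → y j i ≡ 0ℚ
positiveCombination-vanishes {y = y} c i y≥0 xi≡0 j =
  pos*nonneg≡0⇒≡0 (admissible c j) (y≥0 j)
    (sum≡0⇒≡0 (λ j → coeff c j * y j i) term≥0 (trans (represents c i) xi≡0) j)
  where
  term≥0 : ∀ j → 0ℚ ℚ.≤ coeff c j * y j i
  term≥0 j = ℚₚ.nonNegative⁻¹ (coeff c j * y j i)
    {{ℚₚ.nonNeg*nonNeg⇒nonNeg (coeff c j) {{ℚ.nonNegative (ℚₚ.<⇒≤ (admissible c j))}}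
                              (y j i) {{ℚ.nonNegative (y≥0 j)}}}}

-- Distinct parts and sub-multisets

sgn : ℕ → ℕ
sgn ℕ.zero  = 0
sgn (suc _) = 1

suppSize : ∀ {n} → Point n → ℕ
suppSize {ℕ.zero} x = 0
suppSize {suc n}  x = sgn (head x) + suppSize (tail x)

suppEnum : ∀ {n} (x : Point n) → Fin (suppSize x) → Fin n
suppEnum {suc n} x with head x
... | ℕ.zero = suc ∘ suppEnum (tail x)
... | suc _  = zero ∷ suc ∘ suppEnum (tail x)

suppEnum-surjective : ∀ {n} (x : Point n) i → x i ≢ 0 → ∃ λ k → suppEnum x k ≡ i
suppEnum-surjective {suc n} x zero x₀≢0 with head x
... | ℕ.zero = ⊥-elim (x₀≢0 refl)
... | suc _  = zero , refl
suppEnum-surjective {suc n} x (suc i) xi≢0 with head x | suppEnum-surjective (tail x) i xi≢0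
... | ℕ.zero | k , refl = k , refl
... | suc _  | k , refl = suc k , refl

-- subPoint x s takes one copy of the k-th distinct part of x when s k = 1 and none when s k = 0.
subPoint : ∀ {n} (x : Point n) → (Fin (suppSize x) → Fin 2) → Point n
subPoint {suc n} x s with head x
... | ℕ.zero = 0 ∷ subPoint (tail x) s
... | suc _  = toℕ (head s) ∷ subPoint (tail x) (tail s)

subPoint-≤ : ∀ {n} (x : Point n) s i → subPoint x s i ≤ x i
subPoint-≤ {suc n} x s zero with head x
... | ℕ.zero = z≤n
... | suc _  = ℕₚ.≤-trans (ℕₚ.≤-pred (Finₚ.toℕ<n (head s))) (s≤s z≤n)
subPoint-≤ {suc n} x s (suc i) with head x
... | ℕ.zero = subPoint-≤ (tail x) s i
... | suc _  = subPoint-≤ (tail x) (tail s) i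

subPoint-suppEnum : ∀ {n} (x : Point n) s k → subPoint x s (suppEnum x k) ≡ toℕ (s k)
subPoint-suppEnum {suc n} x s k with head x | k
... | ℕ.zero | k     = subPoint-suppEnum (tail x) s k
... | suc _  | zero  = refl
... | suc _  | suc k = subPoint-suppEnum (tail x) (tail s) k

subPoint-injective : ∀ {n} (x : Point n) {s t} → subPoint x s ≗ subPoint x t → s ≗ t
subPoint-injective x {s} {t} s≗t k = Finₚ.toℕ-injective (begin
  toℕ (s k)                   ≡⟨ subPoint-suppEnum x s k ⟨
  subPoint x s (suppEnum x k) ≡⟨ s≗t (suppEnum x k) ⟩
  subPoint x t (suppEnum x k) ≡⟨ subPoint-suppEnum x t k ⟩
  toℕ (t k)                   ∎)
  where open ≡-Reasoning

Σℕ-cong : ∀ {k} {f g : Fin k → ℕ} → f ≗ g → Σℕ f ≡ Σℕ g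
Σℕ-cong {ℕ.zero} f≗g = refl
Σℕ-cong {suc k}  f≗g = cong₂ _+_ (f≗g zero) (Σℕ-cong (f≗g ∘ suc))

Σℕ-+ : ∀ {k} (f g : Fin k → ℕ) → Σℕ (λ i → f i + g i) ≡ Σℕ f + Σℕ g
Σℕ-+ {ℕ.zero} f g = refl
Σℕ-+ {suc k}  f g = trans (cong (f zero + g zero +_) (Σℕ-+ (f ∘ suc) (g ∘ suc)))
                          (interchange (f zero) (g zero) (Σℕ (f ∘ suc)) (Σℕ (g ∘ suc)))
  where
  interchange : ∀ a b c d → (a + b) + (c + d) ≡ (a + c) + (b + d)
  interchange = solve-∀

Σℕ-mono-≤ : ∀ {k} {f g : Fin k → ℕ} → (∀ i → f i ≤ g i) → Σℕ f ≤ Σℕ g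
Σℕ-mono-≤ {ℕ.zero} f≤g = z≤n
Σℕ-mono-≤ {suc k}  f≤g = ℕₚ.+-mono-≤ (f≤g zero) (Σℕ-mono-≤ (f≤g ∘ suc))

weight : ∀ {n} → Point n → ℕ
weight p = Σℕ (λ i → suc (toℕ i) ℕ.* p i)

weight-+ : ∀ {n} (p q : Point n) → weight (λ i → p i + q i) ≡ weight p + weight q
weight-+ p q = trans (Σℕ-cong (λ i → ℕₚ.*-distribˡ-+ (suc (toℕ i)) (p i) (q i)))
                     (Σℕ-+ (λ i → suc (toℕ i) ℕ.* p i) (λ i → suc (toℕ i) ℕ.* q i))

weight-cong : ∀ {n} {p q : Point n} → p ≗ q → weight p ≡ weight q
weight-cong p≗q = Σℕ-cong (λ i → cong (suc (toℕ i) ℕ.*_) (p≗q i))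

weight-mono-≤ : ∀ {n} {p q : Point n} → (∀ i → p i ≤ q i) → weight p ≤ weight q
weight-mono-≤ p≤q = Σℕ-mono-≤ (λ i → ℕₚ.*-monoʳ-≤ (suc (toℕ i)) (p≤q i))

exchange : ∀ {n} → Point n → Point n → Point n → Point n
exchange x A B i = x i ∸ A i + B i

module _ {n} {x A B : Point n} (A≤x : ∀ i → A i ≤ x i) where

  exchange-+ : ∀ i → exchange x A B i + A i ≡ x i + B i
  exchange-+ i = trans (swap (x i ∸ A i) (B i) (A i)) (cong (_+ B i) (ℕₚ.m∸n+n≡m (A≤x i)))
    where
    swap : ∀ a b c → a + b + c ≡ a + c + b
    swap = solve-∀

  exchange-isPartition : IsPartition n x → weight A ≡ weight B → IsPartition n (exchange x A B)
  exchange-isPartition x⊢n wA≡wB = ℕₚ.+-cancelʳ-≡ (weight A) _ _ (begin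
    weight (exchange x A B) + weight A      ≡⟨ weight-+ (exchange x A B) A ⟨
    weight (λ i → exchange x A B i + A i)   ≡⟨ weight-cong exchange-+ ⟩
    weight (λ i → x i + B i)                ≡⟨ weight-+ x B ⟩
    weight x + weight B                     ≡⟨ cong₂ _+_ x⊢n (sym wA≡wB) ⟩
    n + weight A                            ∎)
    where open ≡-Reasoning

  exchange≢ : ¬ (A ≗ B) → exchange x A B ≢ x
  exchange≢ A≉B e≡x = A≉B λ i →
    ℕₚ.+-cancelˡ-≡ (x i) (A i) (B i) (trans (cong (_+ A i) (sym (cong (λ p → p i) e≡x))) (exchange-+ i))

exchange-pair : ∀ {n} {x A B : Point n} → (∀ i → A i ≤ x i) → (∀ i → B i ≤ x i) →
                ∀ i → exchange x A B i + exchange x B A i ≡ x i + x i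
exchange-pair {x = x} {A} {B} A≤x B≤x i =
  trans (swap (x i ∸ A i) (B i) (x i ∸ B i) (A i)) (cong₂ _+_ (ℕₚ.m∸n+n≡m (A≤x i)) (ℕₚ.m∸n+n≡m (B≤x i)))
  where
  swap : ∀ a b c d → (a + b) + (c + d) ≡ (a + d) + (c + b)
  swap = solve-∀

ℕ→ℚ-nonneg : ∀ m → 0ℚ ℚ.≤ ℕ→ℚ m
ℕ→ℚ-nonneg m = ℚₚ.nonNegative⁻¹ (ℕ→ℚ m) {{ℚₚ.normalize-nonNeg m 1}}

ℕ→ℚ-+ : ∀ a b → ℕ→ℚ (a + b) ≡ ℕ→ℚ a ℚ.+ ℕ→ℚ b
ℕ→ℚ-+ a b = ℚₚ.toℚᵘ-injective (begin
  ℚ.toℚᵘ (ℕ→ℚ (a + b))                     ≈⟨ toℚᵘ-ℕ→ℚ (a + b) ⟩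
  mkℚᵘ (ℤ.+ (a + b)) 0                     ≈⟨ ℚᵘ.*≡* (distrib (ℤ.+ a) (ℤ.+ b)) ⟩
  mkℚᵘ (ℤ.+ a) 0 ℚᵘ.+ mkℚᵘ (ℤ.+ b) 0       ≈⟨ ℚᵘₚ.+-cong (toℚᵘ-ℕ→ℚ a) (toℚᵘ-ℕ→ℚ b) ⟨
  ℚ.toℚᵘ (ℕ→ℚ a) ℚᵘ.+ ℚ.toℚᵘ (ℕ→ℚ b)       ≈⟨ ℚₚ.toℚᵘ-homo-+ (ℕ→ℚ a) (ℕ→ℚ b) ⟨
  ℚ.toℚᵘ (ℕ→ℚ a ℚ.+ ℕ→ℚ b)                 ∎)
  where
  open ℚᵘₚ.≃-Reasoning
  toℚᵘ-ℕ→ℚ : ∀ m → ℚ.toℚᵘ (ℕ→ℚ m) ℚᵘ.≃ mkℚᵘ (ℤ.+ m) 0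
  toℚᵘ-ℕ→ℚ m = ℚᵘₚ.≃-reflexive
    (cong ℚ.toℚᵘ (ℚₚ.normalize-coprime (Coprimality.sym (Coprimality.1-coprimeTo m))))
  distrib : ∀ a b → (a ℤ.+ b) ℤ.* ℤ.1ℤ ≡ (a ℤ.* ℤ.1ℤ ℤ.+ b ℤ.* ℤ.1ℤ) ℤ.* ℤ.1ℤ
  distrib = ℤ-Tactic.solve-∀

exchange⇒convComb₂ : ∀ {n} {x A B : Point n} → IsPartition n x → (∀ i → A i ≤ x i) → (∀ i → B i ≤ x i) →
                      weight A ≡ weight B → ¬ (A ≗ B) → ConvComb n x 2
exchange⇒convComb₂ {n} {x} {A} {B} x⊢n A≤x B≤x wA≡wB A≉B =
  exchange x A B ∷ exchange x B A ∷ [] , (λ _ → ℚ.½) ,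
  (λ { zero → exchange-isPartition A≤x x⊢n wA≡wB ; (suc zero) → exchange-isPartition B≤x x⊢n (sym wA≡wB) }) ,
  (λ { zero → exchange≢ A≤x A≉B ; (suc zero) → exchange≢ B≤x (A≉B ∘ (sym ∘_)) }) ,
  (λ _ → ℚₚ.positive⁻¹ ℚ.½) , refl , midpoint
  where
  midpoint : ∀ i → ℚ.½ * ℕ→ℚ (exchange x A B i) ℚ.+ (ℚ.½ * ℕ→ℚ (exchange x B A i) ℚ.+ 0ℚ) ≡ ℕ→ℚ (x i)
  midpoint i = begin
    ℚ.½ * ℕ→ℚ (exchange x A B i) ℚ.+ (ℚ.½ * ℕ→ℚ (exchange x B A i) ℚ.+ 0ℚ)
      ≡⟨ factor (ℕ→ℚ (exchange x A B i)) (ℕ→ℚ (exchange x B A i)) ⟩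
    ℚ.½ * (ℕ→ℚ (exchange x A B i) ℚ.+ ℕ→ℚ (exchange x B A i))
      ≡⟨ cong (ℚ.½ *_) (ℕ→ℚ-+ (exchange x A B i) (exchange x B A i)) ⟨
    ℚ.½ * ℕ→ℚ (exchange x A B i + exchange x B A i)
      ≡⟨ cong (λ m → ℚ.½ * ℕ→ℚ m) (exchange-pair A≤x B≤x i) ⟩
    ℚ.½ * ℕ→ℚ (x i + x i)
      ≡⟨ cong (ℚ.½ *_) (ℕ→ℚ-+ (x i) (x i)) ⟩
    ℚ.½ * (ℕ→ℚ (x i) ℚ.+ ℕ→ℚ (x i))
      ≡⟨ halve (ℕ→ℚ (x i)) ⟩
    ℕ→ℚ (x i) ∎
    where
    open ≡-Reasoning
    factor : ∀ a b → ℚ.½ * a ℚ.+ (ℚ.½ * b ℚ.+ 0ℚ) ≡ ℚ.½ * (a ℚ.+ b)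
    factor = solve 2 (λ a b → con ℚ.½ :* a :+ (con ℚ.½ :* b :+ con 0ℚ) := con ℚ.½ :* (a :+ b)) refl
    halve : ∀ a → ℚ.½ * (a ℚ.+ a) ≡ a
    halve = solve 1 (λ a → con ℚ.½ :* (a :+ a) := a) refl

-- Shortest convex combinations

homogenize : ∀ {n} → Point n → Fin (suc n) → ℚ
homogenize p = 1ℚ ∷ ℕ→ℚ ∘ p

OtherPartitions : (n : ℕ) → Point n → ∀ {k} → (Fin k → Point n) → Set
OtherPartitions n x y = ∀ j → IsPartition n (y j) × y j ≢ x

Σℚ≡sum : ∀ {k} (f : Fin k → ℚ) → Σℚ f ≡ sum f
Σℚ≡sum {ℕ.zero} f = refl
Σℚ≡sum {suc k}  f = cong (f zero ℚ.+_) (Σℚ≡sum (f ∘ suc))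

module _ {n : ℕ} {x : Point n} {k : ℕ} where

  convComb⇒positiveCombination : ConvComb n x k → Σ (Fin k → Point n) λ y →
                                 OtherPartitions n x y × PositiveCombination (homogenize ∘ y) (homogenize x)
  convComb⇒positiveCombination (y , λs , y⊢n , y≢x , λs>0 , Σλs≡1 , λs·y≡x) = y , (λ j → y⊢n j , y≢x j) , record
    { coeff      = λs
    ; admissible = λs>0
    ; represents = λ where
        zero    → trans (sum-cong-≗ (ℚₚ.*-identityʳ ∘ λs)) (trans (sym (Σℚ≡sum λs)) Σλs≡1)
        (suc i) → trans (sym (Σℚ≡sum (λ j → λs j * ℕ→ℚ (y j i)))) (λs·y≡x i)
    }

  positiveCombination⇒convComb : (y : Fin k → Point n) → OtherPartitions n x y →
                                 PositiveCombination (homogenize ∘ y) (homogenize x) → ConvComb n x k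
  positiveCombination⇒convComb y others c =
    y , coeff c , proj₁ ∘ others , proj₂ ∘ others , admissible c ,
    trans (Σℚ≡sum (coeff c)) (trans (sym (sum-cong-≗ (ℚₚ.*-identityʳ ∘ coeff c))) (represents c zero)) ,
    λ i → trans (Σℚ≡sum (λ j → coeff c j * ℕ→ℚ (y j i))) (represents c (suc i))

homogenize-supportedIn : ∀ {n k} {x : Point n} {y : Fin k → Point n} →
                         PositiveCombination (homogenize ∘ y) (homogenize x) →
                         SupportedIn (zero ∷ suc ∘ suppEnum x) (homogenize ∘ y)
homogenize-supportedIn c zero = inj₁ (zero , refl)
homogenize-supportedIn {x = x} {y} c (suc i) with x i ℕ.≟ 0
... | yes xi≡0 = inj₂ (positiveCombination-vanishes c (suc i) (λ j → ℕ→ℚ-nonneg (y j i)) (cong ℕ→ℚ xi≡0))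
... | no xi≢0  = let (k , suppEnum-k≡i) = suppEnum-surjective x i xi≢0 in inj₁ (suc k , cong suc suppEnum-k≡i)

minimal⇒≤1+suppSize : ∀ {n x ξ} → ConvComb n x ξ → (∀ k → k < ξ → ¬ ConvComb n x k) → ξ ≤ suc (suppSize x)
minimal⇒≤1+suppSize {x = x} comb minimal = ℕₚ.≮⇒≥ λ 1+d<ξ →
  let (y , others , c) = convComb⇒positiveCombination comb
      dependency = linearDependency-supportedIn (homogenize ∘ y) (homogenize-supportedIn {x = x} {y} c) 1+d<ξ
      (k′ , k′<ξ , ι , c′) = caratheodory c dependency
  in minimal k′ k′<ξ (positiveCombination⇒convComb (y ∘ ι) (others ∘ ι) c′)

-- Counting sub-multisets

funToFin-cong : ∀ {d c} {s t : Fin d → Fin c} → s ≗ t → Fin.funToFin s ≡ Fin.funToFin t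
funToFin-cong {ℕ.zero} s≗t = refl
funToFin-cong {suc d}  s≗t = cong₂ Fin.combine (s≗t zero) (funToFin-cong (s≗t ∘ suc))

pigeonhole-functions : ∀ {c d m} → m < c ^ d → (f : (Fin d → Fin c) → Fin m) →
                       Σ (Fin d → Fin c) λ s → Σ (Fin d → Fin c) λ t → ¬ (s ≗ t) × f s ≡ f t
pigeonhole-functions {c} {d} m<c^d f =
  let (a , b , a<b , fa≡fb) = Finₚ.pigeonhole m<c^d (f ∘ Fin.finToFun)
  in Fin.finToFun a , Fin.finToFun b , (λ a≗b → Finₚ.<-irrefl (finToFun-injective a≗b) a<b) , fa≡fb
  where
  finToFun-injective : ∀ {a b : Fin (c ^ d)} → Fin.finToFun a ≗ Fin.finToFun b → a ≡ b
  finToFun-injective {a} {b} a≗b = begin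
    a                                       ≡⟨ Finₚ.funToFin-finToFin {d} {c} a ⟨
    Fin.funToFin (Fin.finToFun {c} {d} a)   ≡⟨ funToFin-cong a≗b ⟩
    Fin.funToFin (Fin.finToFun {c} {d} b)   ≡⟨ Finₚ.funToFin-finToFin {d} {c} b ⟩
    b                                       ∎
    where open ≡-Reasoning

¬convComb₂⇒2^suppSize≤1+n : ∀ {n x} → IsPartition n x → ¬ ConvComb n x 2 → 2 ^ suppSize x ≤ suc n
¬convComb₂⇒2^suppSize≤1+n {n} {x} x⊢n ¬comb₂ = ℕₚ.≮⇒≥ λ 1+n<2^d →
  let (s , t , s≉t , ws≡wt) = pigeonhole-functions 1+n<2^d subsetWeight
  in ¬comb₂ (exchange⇒convComb₂ x⊢n (subPoint-≤ x s) (subPoint-≤ x t)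
              (Finₚ.fromℕ<-injective _ _ (weight<1+n s) (weight<1+n t) ws≡wt) (s≉t ∘ subPoint-injective x))
  where
  weight<1+n : ∀ s → weight (subPoint x s) < suc n
  weight<1+n s = s≤s (ℕₚ.≤-trans (weight-mono-≤ (subPoint-≤ x s)) (ℕₚ.≤-reflexive x⊢n))
  subsetWeight : (Fin (suppSize x) → Fin 2) → Fin (suc n)
  subsetWeight s = Fin.fromℕ< (weight<1+n s)

2^≤⇒≤⌊log₂⌋ : ∀ {d m} → 2 ^ d ≤ m → d ≤ ⌊log₂ m ⌋
2^≤⇒≤⌊log₂⌋ {d} 2^d≤m = ℕₚ.≤-trans (ℕₚ.≤-reflexive (sym (⌊log₂[2^n]⌋≡n d))) (⌊log₂⌋-mono-≤ 2^d≤m)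

theorem2 : (n ξ : ℕ) → 1 ≤ n → 2 < ξ →
    ∃ (λ x → InC ξ n x) →
    ξ ≤ ⌊log₂ (suc n) ⌋ + 1
theorem2 n ξ _ 2<ξ (x , x⊢n , _ , comb , minimal) = begin
  ξ                    ≤⟨ minimal⇒≤1+suppSize comb minimal ⟩
  suc (suppSize x)     ≤⟨ s≤s (2^≤⇒≤⌊log₂⌋ (¬convComb₂⇒2^suppSize≤1+n x⊢n (minimal 2 2<ξ))) ⟩
  suc ⌊log₂ (suc n) ⌋  ≡⟨ ℕₚ.+-comm 1 ⌊log₂ (suc n) ⌋ ⟩
  ⌊log₂ (suc n) ⌋ + 1  ∎
  where open ℕₚ.≤-Reasoning
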